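{- Suppose the input graph is a cactus graph, revealed in an admissible order $v_1,\dots,v_n$, and the algorithm $2$-DOMINATE is run on it. If $\deg(v_i)\ge 4$, then $v_i$ is selected by $2$-DOMINATE.
   Context: A cactus graph is a connected graph in which every edge lies on at most one cycle. Online dominating set model: a finite connected simple undirected graph $G$ is revealed in an order $v_1,\dots,v_n$ such that for every $i$ the subgraph induced on $\{v_1,\dots,v_i\}$ is connected; at step $i$, $v_i$ is revealed together with its entire closed neighbourhood $N[v_i]$, and the algorithm irrevocably decides whether to select $v_i$. Notation: $R_i=\{v_1,\dots,v_i\}$, $V_i=N[R_i]$; $S_i$ = vertices among $v_1,\dots,v_i$ selected, $S_0=\emptyset$; $D_i=N[S_i]$; $U_i=V_i\setminus D_{i-1}$. $v_j$ saves $v_i$ if $j=\max\{k: v_k\in N[v_i]\}$ and $N[v_i]\setminus\{v_j\}$ contains no vertex of $S_{j-1}$; $s(v_j)$ is the set of vertices saved by $v_j$. The algorithm $k$-DOMINATE selects $v_i$ iff $|N(v_i)\cap U_i|\ge k$ or $|s(v_i)|\ge1$. -}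

module Defs where

open import Data.Nat using (ℕ; _≤_; _≤ᵇ_; _<ᵇ_)
open import Data.Fin using (Fin; toℕ; _≟_)
open import Data.Bool using (Bool; true; false; _∧_; _∨_; not; if_then_else_)
open import Data.List using (List; []; _∷_; _++_; take; length; allFin; map)
open import Data.Bool.ListAction using (any; all)
open import Data.Nat.ListAction using (sum)
open import Data.List.Relation.Unary.Unique.Propositional using (Unique)
open import Data.Unit using (⊤)
open import Data.Product using (_×_)
open import Data.Sum using (_⊎_)
open import Relation.Binary.PropositionalEquality using (_≡_)
open import Relation.Nullary.Decidable using (⌊_⌋)
open import Function.Bundles using (_⇔_)

-- Convention: the graph has vertex set Fin n, and vertex i (0-indexed) is the
-- vertex revealed at step i+1 (i.e. v_{i+1} in the paper).  Any graph with a
-- revealing order is relabelled this way.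

record Graph (n : ℕ) : Set where
  field
    adj    : Fin n → Fin n → Bool
    sym    : ∀ u v → adj u v ≡ adj v u
    irrefl : ∀ v → adj v v ≡ false
open Graph public

module _ {n : ℕ} (G : Graph n) where

  Adj : Fin n → Fin n → Set
  Adj u v = adj G u v ≡ true

  cnb : Fin n → Fin n → Bool
  cnb u v = ⌊ u ≟ v ⌋ ∨ adj G u v

  countB : (Fin n → Bool) → ℕ
  countB f = sum (map (λ x → if f x then 1 else 0) (allFin n))

  deg : Fin n → ℕ
  deg v = countB (adj G v)

  data WalkIn (P : Fin n → Set) : Fin n → Fin n → Set where
    stop : ∀ {u} → P u → WalkIn P u u
    step : ∀ {u w v} → P u → Adj u w → WalkIn P w v → WalkIn P u v

  Connected : Set
  Connected = ∀ u v → WalkIn (λ _ → ⊤) u v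

  Admissible : Set
  Admissible = ∀ (i u v : Fin n) → toℕ u ≤ toℕ i → toℕ v ≤ toℕ i →
               WalkIn (λ w → toℕ w ≤ toℕ i) u v

  data Consec : List (Fin n) → Fin n → Fin n → Set where
    here  : ∀ {u v xs} → Consec (u ∷ v ∷ xs) u v
    there : ∀ {x xs u v} → Consec xs u v → Consec (x ∷ xs) u v

  closed : List (Fin n) → List (Fin n)
  closed c = c ++ take 1 c

  IsCycle : List (Fin n) → Set
  IsCycle c = (3 ≤ length c) × Unique c × (∀ u v → Consec (closed c) u v → Adj u v)

  EdgeOf : List (Fin n) → Fin n → Fin n → Set
  EdgeOf c u v = Consec (closed c) u v ⊎ Consec (closed c) v u

  -- cactus: connected, and every edge lies on at most one cycle
  -- (two cycles through a common edge have the same edge set, i.e. are the same cycle)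
  Cactus : Set
  Cactus = Connected ×
    (∀ c c' u v → IsCycle c → IsCycle c' → Adj u v → EdgeOf c u v → EdgeOf c' u v →
       ∀ x y → EdgeOf c x y ⇔ EdgeOf c' x y)

  module Step (sel : Fin n → Bool) (i : Fin n) where

    inD : Fin n → Bool
    inD u = any (λ j → (toℕ j <ᵇ toℕ i) ∧ sel j ∧ cnb j u) (allFin n)

    inV : Fin n → Bool
    inV u = any (λ j → (toℕ j ≤ᵇ toℕ i) ∧ cnb j u) (allFin n)

    inU : Fin n → Bool
    inU u = inV u ∧ not (inD u)

    newCount : ℕ
    newCount = countB (λ u → adj G i u ∧ inU u)

    saves : Fin n → Bool
    saves u = cnb u i
            ∧ all (λ k → not (cnb u k) ∨ (toℕ k ≤ᵇ toℕ i)) (allFin n)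
            ∧ all (λ j → not (cnb u j ∧ not ⌊ j ≟ i ⌋ ∧ (toℕ j <ᵇ toℕ i) ∧ sel j)) (allFin n)

    savesSome : Bool
    savesSome = any saves (allFin n)

  IsRun : ℕ → (Fin n → Bool) → Set
  IsRun k sel = ∀ i → sel i ≡ ((k ≤ᵇ Step.newCount sel i) ∨ Step.savesSome sel i)

-- If v_i is not selected, at most one neighbour of v_i is new (in U_i), so at least three
-- neighbours a, b, c are already dominated by vertices revealed before v_i.  Those earlier
-- vertices induce a connected subgraph, so a, b, c are pairwise joined by walks avoiding v_i.
-- Closing a path a ⋯ b and a path a ⋯ c through v_i gives two cycles sharing the edge
-- {v_i, a}; in a cactus they must be equal, but {b, v_i} lies on the first cycle and not
-- on the second.
module Submission where

open import Defs hiding (sym)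
open import Data.Nat using (ℕ; _≤_; _<_; z≤n; s≤s; suc; _+_; _≤ᵇ_; _<ᵇ_)
open import Data.Nat.Properties
  using (≤-refl; ≤-trans; <-≤-trans; ≤-pred; <-irrefl; ≤-total; ≰⇒>; ≤⇒≤ᵇ; <ᵇ⇒<; +-suc; +-monoˡ-≤)
open import Data.Fin using (Fin; toℕ; _≟_)
open import Data.Bool using (Bool; true; false; _∧_; _∨_; not; if_then_else_; T)
open import Data.Bool.Properties using (T-∧; T-∨; T-≡; ∨-conicalˡ)
open import Data.List using (List; []; _∷_; _++_; map; length; allFin; filterᵇ)
open import Data.Nat.ListAction using (sum)
open import Data.List.Relation.Unary.All using (All; []; _∷_) renaming (map to All-map)
open import Data.List.Relation.Unary.All.Properties.Core using (¬Any⇒All¬)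
open import Data.List.Relation.Unary.Any using (here; there; satisfied)
open import Data.List.Relation.Unary.Any.Properties using (any⁺; any⁻)
open import Data.List.Relation.Unary.AllPairs using ([]; _∷_)
open import Data.List.Relation.Unary.Unique.Propositional using (Unique)
open import Data.List.Relation.Unary.Unique.Propositional.Properties using (allFin⁺; filter⁺)
open import Data.List.Membership.Propositional using (_∈_; lose)
open import Data.List.Membership.Propositional.Properties using (∈-allFin; ∈-filter⁻)
open import Data.Product using (∃-syntax; _×_; _,_; proj₁; proj₂)
open import Data.Sum using (_⊎_; inj₁; inj₂; [_,_]′)
open import Data.Empty using (⊥; ⊥-elim)
open import Function using (_$_; _∘_)
open import Function.Bundles using (Equivalence)
open import Relation.Nullary using (¬_; yes; no)
open import Relation.Nullary.Decidable using (⌊_⌋; toWitness; T?)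
open import Relation.Binary.PropositionalEquality using (_≡_; _≢_; refl; sym; trans; cong; subst; ≢-sym)

open Equivalence using (to; from)

module _ {A : Set} where

  count : (A → Bool) → List A → ℕ
  count p xs = sum (map (λ x → if p x then 1 else 0) xs)

  count-∧-split : ∀ (p q : A → Bool) xs →
    count p xs ≡ count (λ x → p x ∧ q x) xs + count (λ x → p x ∧ not (q x)) xs
  count-∧-split p q [] = refl
  count-∧-split p q (x ∷ xs) with p x | q x | count-∧-split p q xs
  ... | true  | true  | ih = cong suc ih
  ... | true  | false | ih = trans (cong suc ih) (sym (+-suc _ _))
  ... | false | _     | ih = ih

  count≡length-filterᵇ : ∀ (p : A → Bool) xs → count p xs ≡ length (filterᵇ p xs)
  count≡length-filterᵇ p [] = refl
  count≡length-filterᵇ p (x ∷ xs) with p x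
  ... | true  = cong suc (count≡length-filterᵇ p xs)
  ... | false = count≡length-filterᵇ p xs

  record Distinct3 (P : A → Set) : Set where
    constructor distinct3
    field
      {x y z} : A
      x≢y     : x ≢ y
      x≢z     : x ≢ z
      y≢z     : y ≢ z
      P[x]    : P x
      P[y]    : P y
      P[z]    : P z

  distinct3-∈ : ∀ {xs} → Unique xs → 3 ≤ length xs → Distinct3 (_∈ xs)
  distinct3-∈ ((x≢y ∷ x≢z ∷ _) ∷ (y≢z ∷ _) ∷ _) (s≤s (s≤s (s≤s _))) =
    distinct3 x≢y x≢z y≢z (here refl) (there (here refl)) (there (there (here refl)))

  distinct3-count : ∀ (p : A → Bool) {xs} → Unique xs → 3 ≤ count p xs → Distinct3 (λ x → T (p x))
  distinct3-count p {xs} uniq 3≤count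
    with distinct3-∈ (filter⁺ _ uniq) (subst (3 ≤_) (count≡length-filterᵇ p xs) 3≤count)
  ... | distinct3 x≢y x≢z y≢z x∈ y∈ z∈ =
    distinct3 x≢y x≢z y≢z (satisfies x∈) (satisfies y∈) (satisfies z∈)
    where
    satisfies : ∀ {x} → x ∈ filterᵇ p xs → T (p x)
    satisfies x∈ = proj₂ (∈-filter⁻ (λ x → T? (p x)) {xs = xs} x∈)

module _ {n : ℕ} (G : Graph n) where

  open import Data.List.Membership.DecPropositional (_≟_ {n}) using (_∈?_)

  Adj-sym : ∀ {u v} → Adj G u v → Adj G v u
  Adj-sym {u} {v} u~v = trans (Graph.sym G v u) u~v

  Adj⇒≢ : ∀ {u v} → Adj G u v → u ≢ v
  Adj⇒≢ {u} u~u refl with trans (sym u~u) (Graph.irrefl G u)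
  ... | ()

  walk-++ : ∀ {P u w v} → WalkIn G P u w → WalkIn G P w v → WalkIn G P u v
  walk-++ (stop _)       q = q
  walk-++ (step p u~w r) q = step p u~w (walk-++ r q)

  walk-map : ∀ {P Q : Fin n → Set} {u v} → (∀ {x} → P x → Q x) → WalkIn G P u v → WalkIn G Q u v
  walk-map f (stop p)       = stop (f p)
  walk-map f (step p u~w r) = step (f p) u~w (walk-map f r)

  _∈N[_] : Fin n → Fin n → Set
  x ∈N[ w ] = w ≡ x ⊎ Adj G w x

  walk-fromNbr : ∀ {P x w v} → P x → x ∈N[ w ] → WalkIn G P w v → WalkIn G P x v
  walk-fromNbr _  (inj₁ refl) r = r
  walk-fromNbr Px (inj₂ w~x)  r = step Px (Adj-sym w~x) r

  walk-toNbr : ∀ {P u w x} → P w → P x → x ∈N[ w ] → WalkIn G P u w → WalkIn G P u x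
  walk-toNbr _  _  (inj₁ refl) r = r
  walk-toNbr Pw Px (inj₂ w~x)  r = walk-++ r (step Pw w~x (stop Px))

  data AdjChain : Fin n → List (Fin n) → Fin n → Set where
    []  : ∀ {a} → AdjChain a [] a
    _∷_ : ∀ {a w ys b} → Adj G a w → AdjChain w ys b → AdjChain a (w ∷ ys) b

  record PathIn (P : Fin n → Set) (a b : Fin n) : Set where
    constructor path
    field
      {inner} : List (Fin n)
      chain   : AdjChain a inner b
      unique  : Unique (a ∷ inner)
      inside  : All P (a ∷ inner)

  path-suffix : ∀ {P a w ys b} → a ∈ w ∷ ys → AdjChain w ys b → Unique (w ∷ ys) → All P (w ∷ ys) →
                PathIn P a b
  path-suffix (here refl) ch       uniq       Pys       = path ch uniq Pys
  path-suffix (there a∈)  (_ ∷ ch) (_ ∷ uniq) (_ ∷ Pys) = path-suffix a∈ ch uniq Pys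

  walk⇒path : ∀ {P a b} → WalkIn G P a b → PathIn P a b
  walk⇒path (stop Pa) = path [] ([] ∷ []) (Pa ∷ [])
  walk⇒path {a = a} (step {w = w} Pa a~w r) with walk⇒path r
  ... | path {ys} ch uniq Pys with a ∈? w ∷ ys
  ... | yes a∈ = path-suffix a∈ ch uniq Pys
  ... | no a∉  = path (a~w ∷ ch) (¬Any⇒All¬ _ a∉ ∷ uniq) (Pa ∷ Pys)

  chain-Consec⇒Adj : ∀ {i a ys b u v} → AdjChain a ys b → Adj G b i →
                     Consec G (a ∷ ys ++ i ∷ []) u v → Adj G u v
  chain-Consec⇒Adj []         b~i here               = b~i
  chain-Consec⇒Adj []         b~i (there (there ()))
  chain-Consec⇒Adj (a~w ∷ ch) b~i here               = a~w
  chain-Consec⇒Adj (a~w ∷ ch) b~i (there c)          = chain-Consec⇒Adj ch b~i c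

  chain-Consec-last : ∀ {i a ys b} → AdjChain a ys b → Consec G (a ∷ ys ++ i ∷ []) b i
  chain-Consec-last []       = here
  chain-Consec-last (_ ∷ ch) = there (chain-Consec-last ch)

  chain-Consec-into : ∀ {i a ys b x} → AdjChain a ys b → All (_≢ i) (a ∷ ys) →
                      Consec G (a ∷ ys ++ i ∷ []) x i → x ≡ b
  chain-Consec-into []       _             here               = refl
  chain-Consec-into []       _             (there (there ()))
  chain-Consec-into (_ ∷ ch) (_ ∷ w≢i ∷ _) here               = ⊥-elim (w≢i refl)
  chain-Consec-into (_ ∷ ch) (_ ∷ ys≢i)    (there c)          = chain-Consec-into ch ys≢i c

  ¬Consec-from : ∀ {i y} xs → All (_≢ i) xs → ¬ Consec G (xs ++ i ∷ []) i y
  ¬Consec-from []            _          (there ())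
  ¬Consec-from (x ∷ [])      (x≢i ∷ _)  here               = x≢i refl
  ¬Consec-from (x ∷ [])      _          (there (there ()))
  ¬Consec-from (x ∷ x′ ∷ xs) (x≢i ∷ _)  here               = x≢i refl
  ¬Consec-from (x ∷ x′ ∷ xs) (_ ∷ xs≢i) (there c)          = ¬Consec-from (x′ ∷ xs) xs≢i c

  cycle-edge-at-apex : ∀ {i a ys c x} → AdjChain a ys c → All (_≢ i) (a ∷ ys) → x ≢ i →
                       EdgeOf G (i ∷ a ∷ ys) x i → x ≡ a ⊎ x ≡ c
  cycle-edge-at-apex ch _    x≢i (inj₁ here)      = ⊥-elim (x≢i refl)
  cycle-edge-at-apex ch ys≢i _   (inj₁ (there c)) = inj₂ (chain-Consec-into ch ys≢i c)
  cycle-edge-at-apex ch _    _   (inj₂ here)      = inj₁ refl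
  cycle-edge-at-apex ch ys≢i _   (inj₂ (there c)) = ⊥-elim (¬Consec-from _ ys≢i c)

  path⇒cycle : ∀ {i a b ys} → Adj G i a → Adj G i b → a ≢ b → AdjChain a ys b →
               Unique (a ∷ ys) → All (_≢ i) (a ∷ ys) → IsCycle G (i ∷ a ∷ ys)
  path⇒cycle i~a i~b a≢b []         _    _    = ⊥-elim (a≢b refl)
  path⇒cycle i~a i~b a≢b ch@(_ ∷ _) uniq ys≢i =
    s≤s (s≤s (s≤s z≤n)) ,
    All-map ≢-sym ys≢i ∷ uniq ,
    λ { _ _ here → i~a ; _ _ (there c) → chain-Consec⇒Adj ch (Adj-sym i~b) c }

  cactus-¬neighbour-paths : Cactus G → ∀ {i a b c} → Adj G i a → Adj G i b → Adj G i c →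
    a ≢ b → a ≢ c → b ≢ c → PathIn (_≢ i) a b → PathIn (_≢ i) a c → ⊥
  cactus-¬neighbour-paths (_ , one-cycle-per-edge) {i} {a} {b} i~a i~b i~c a≢b a≢c b≢c
    (path ch₁ uniq₁ ys₁≢i) (path ch₂ uniq₂ ys₂≢i)
    = [ a≢b ∘ sym , b≢c ]′ (cycle-edge-at-apex ch₂ ys₂≢i (≢-sym (Adj⇒≢ i~b)) bi∈C₂)
    where
    bi∈C₂ : EdgeOf G (i ∷ a ∷ _) b i
    bi∈C₂ = to (one-cycle-per-edge _ _ i a
                  (path⇒cycle i~a i~b a≢b ch₁ uniq₁ ys₁≢i) (path⇒cycle i~a i~c a≢c ch₂ uniq₂ ys₂≢i)
                  i~a (inj₁ here) (inj₁ here) b i)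
               (inj₁ (there (chain-Consec-last ch₁)))

  DominatedBefore : Fin n → Fin n → Set
  DominatedBefore i x = ∃[ w ] toℕ w < toℕ i × x ∈N[ w ]

  dominatedBefore-linked : Admissible G → ∀ {i a b} → a ≢ i → b ≢ i →
    DominatedBefore i a → DominatedBefore i b → WalkIn G (_≢ i) a b
  dominatedBefore-linked adm {i} a≢i b≢i (wa , wa<i , a∈N[wa]) (wb , wb<i , b∈N[wb]) =
    walk-fromNbr a≢i a∈N[wa] (walk-toNbr (<⇒≢ wb<i) b≢i b∈N[wb] wa⋯wb)
    where
    <⇒≢ : ∀ {w} → toℕ w < toℕ i → w ≢ i
    <⇒≢ w<i refl = <-irrefl refl w<i

    before : ∀ {w} → toℕ w < toℕ i → ∀ {x} → toℕ x ≤ toℕ w → x ≢ i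
    before w<i x≤w = <⇒≢ (<-≤-trans (s≤s x≤w) w<i)

    wa⋯wb : WalkIn G (_≢ i) wa wb
    wa⋯wb with ≤-total (toℕ wa) (toℕ wb)
    ... | inj₁ wa≤wb = walk-map (before wb<i) (adm wb wa wb wa≤wb ≤-refl)
    ... | inj₂ wb≤wa = walk-map (before wa<i) (adm wa wa wb ≤-refl wb≤wa)

  module _ (sel : Fin n → Bool) (i : Fin n) where
    open Step G sel i

    unselected⇒newCount< : ∀ {k} → IsRun G k sel → sel i ≡ false → newCount < k
    unselected⇒newCount< {k} run unselected = ≰⇒> λ k≤newCount →
      subst T (∨-conicalˡ _ _ (trans (sym (run i)) unselected)) (≤⇒≤ᵇ k≤newCount)

    neighbour-inV : ∀ {x} → Adj G i x → T (inV x)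
    neighbour-inV {x} i~x = any⁺ _ (lose (∈-allFin i) i-reaches-x)
      where
      i-reaches-x : T ((toℕ i ≤ᵇ toℕ i) ∧ cnb G i x)
      i-reaches-x = from (T-∧ {toℕ i ≤ᵇ toℕ i}) (≤⇒≤ᵇ (≤-refl {toℕ i}) ,
                      from (T-∨ {⌊ i ≟ x ⌋}) (inj₂ (from T-≡ i~x)))

    inD⇒dominatedBefore : ∀ {x} → T (inD x) → DominatedBefore i x
    inD⇒dominatedBefore {x} x∈D with satisfied (any⁻ _ (allFin n) x∈D)
    ... | w , w-dominates with to (T-∧ {toℕ w <ᵇ toℕ i}) w-dominates
    ...   | w<ᵇi , sel[w]∧x∈N with to (T-∨ {⌊ w ≟ x ⌋}) (proj₂ (to (T-∧ {sel w}) sel[w]∧x∈N))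
    ...     | inj₁ w≡x = w , <ᵇ⇒< _ _ w<ᵇi , inj₁ (toWitness w≡x)
    ...     | inj₂ w~x = w , <ᵇ⇒< _ _ w<ᵇi , inj₂ (to T-≡ w~x)

    oldNeighbour-dominatedBefore : ∀ {x} → T (adj G i x ∧ not (inU x)) → DominatedBefore i x
    oldNeighbour-dominatedBefore {x} old with to (T-∧ {adj G i x}) old
    ... | i~x , x∉U = inD⇒dominatedBefore (V∖U⊆D (inV x) (inD x) (neighbour-inV (to T-≡ i~x)) x∉U)
      where
      V∖U⊆D : ∀ v d → T v → T (not (v ∧ not d)) → T d
      V∖U⊆D true true  _ _ = _

corollary3 : ∀ (n : ℕ) (G : Graph n) → Cactus G → Admissible G →
    ∀ (sel : Fin n → Bool) → IsRun G 2 sel →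
    ∀ (i : Fin n) → 4 ≤ deg G i → sel i ≡ true
corollary3 n G cactus adm sel run i 4≤deg with sel i in sel[i]
... | true  = refl
... | false = ⊥-elim (cactus-¬neighbour-paths G cactus
                        (neighbour P[x]) (neighbour P[y]) (neighbour P[z]) x≢y x≢z y≢z
                        (linked P[x] P[y]) (linked P[x] P[z]))
  where
  open Step G sel i

  old : Fin n → Bool
  old u = adj G i u ∧ not (inU u)

  -- deg i = newCount + count old, and newCount < 2.
  5≤2+old : 5 ≤ 2 + count old (allFin n)
  5≤2+old = ≤-trans (s≤s (subst (4 ≤_) (count-∧-split (adj G i) inU (allFin n)) 4≤deg))
                    (+-monoˡ-≤ _ (unselected⇒newCount< G sel i run sel[i]))

  open Distinct3 (distinct3-count old (allFin⁺ n) (≤-pred (≤-pred 5≤2+old)))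

  neighbour : ∀ {u} → T (old u) → Adj G i u
  neighbour {u} old[u] = to T-≡ (proj₁ (to (T-∧ {adj G i u}) old[u]))

  linked : ∀ {u v} → T (old u) → T (old v) → PathIn G (_≢ i) u v
  linked old[u] old[v] = walk⇒path G $ dominatedBefore-linked G adm
    (≢-sym (Adj⇒≢ G (neighbour old[u]))) (≢-sym (Adj⇒≢ G (neighbour old[v])))
    (oldNeighbour-dominatedBefore G sel i old[u]) (oldNeighbour-dominatedBefore G sel i old[v])
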